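{- Let $u$ and $v$ be $\mathbf c\mathbf d$-monomials. Then $\beta(u \cdot v) = \beta(u \cdot v^*) = \beta(u^* \cdot v)$ and $\beta(u \cdot v) = \beta(v \cdot u)$.
   Context: Let $\mathcal F = k\langle \mathbf c,\mathbf d\rangle$ ($k$ a field of characteristic 0, $\deg\mathbf c=1$, $\deg\mathbf d=2$) and $\hat{\mathcal F}=ke\oplus\mathcal F$ with $e$ a formal symbol of degree $-1$. Define $\Delta$ on $\mathcal F$ by $\Delta(1)=0$, $\Delta(\mathbf c)=2(1\otimes1)$, $\Delta(\mathbf d)=1\otimes\mathbf c+\mathbf c\otimes1$, $\Delta(uv)=\Delta(u)v+u\Delta(v)$, and $\hat\Delta(e)=e\otimes e$, $\hat\Delta(u)=\Delta(u)+e\otimes u+u\otimes e$. The product $\cdot$ on $\hat{\mathcal F}$ is the transpose of $\hat\Delta$ with respect to the monomial basis: the coefficient of $w$ in $u\cdot v$ equals the coefficient of $u\otimes v$ in $\hat\Delta(w)$. Explicitly, writing $\mathbf c^{m_1}\mathbf d\cdots\mathbf d\mathbf c^{m_k}$ as the list $(m_1,\dots,m_k)$, $(M',m)\cdot(n,N')=(M',m-1,n,N')+(M',m,n-1,N')+2(M',m+n+1,N')$ (lists with negative entries are zero), and $e$ is the unit. For a $\mathbf c\mathbf d$-monomial $v$ of degree $n$, $\beta(v)$ is the coefficient of $v$ in the $\mathbf c\mathbf d$-index $\Psi(B_{n+1})$ of the Boolean lattice of rank $n+1$; $\beta(e)=1$, extended linearly. $v^*$ denotes the monomial $v$ written in reverse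 order. -}

module Defs where

open import Data.Nat using (ℕ; zero; suc)
open import Data.Nat.Combinatorics using (_C_)
open import Data.Integer using (ℤ; +_; -_; _*_; _+_; 0ℤ; 1ℤ)
open import Data.Bool using (Bool; true; false; _xor_; if_then_else_)
open import Data.List using (List; []; _∷_; _++_; map; foldr; reverse; length; [_])
open import Data.Maybe using (Maybe; just; nothing)
open import Data.Product using (_×_; _,_)
open import Relation.Binary.PropositionalEquality using (_≡_)

data CD : Set where
  c d : CD

CDMon : Set
CDMon = List CD

deg : CDMon → ℕ
deg [] = 0
deg (c ∷ w) = suc (deg w)
deg (d ∷ w) = suc (suc (deg w))

_⋆ : CDMon → CDMon
v ⋆ = reverse v

-- all cd-monomials of degree n (each exactly once)
cdMons : ℕ → List CDMon
cdMons zero = [] ∷ []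
cdMons (suc zero) = (c ∷ []) ∷ []
cdMons (suc (suc n)) = map (c ∷_) (cdMons (suc n)) ++ map (d ∷_) (cdMons n)

Lin : Set
Lin = List (ℤ × CDMon)

sumℤ : List ℤ → ℤ
sumℤ = foldr _+_ 0ℤ

-- remove a leading c (the "n-1" in the list notation); nothing = zero term
dropFirstC : CDMon → Maybe CDMon
dropFirstC (c ∷ v) = just v
dropFirstC _ = nothing

-- remove a trailing c (the "m-1" in the list notation)
dropLastC : CDMon → Maybe CDMon
dropLastC u with dropFirstC (reverse u)
... | just u' = just (reverse u')
... | nothing = nothing

opt : Maybe CDMon → (CDMon → ℤ × CDMon) → Lin
opt (just x) f = f x ∷ []
opt nothing f = []

-- (M',m)·(n,N') = (M',m-1,n,N') + (M',m,n-1,N') + 2(M',m+n+1,N'),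
-- i.e. for u = U c^m, v = c^n V:
--   u·v = (u minus last c) d v + u d (v minus first c) + 2 u c v
_·_ : CDMon → CDMon → Lin
u · v = opt (dropLastC u) (λ u' → (1ℤ , u' ++ d ∷ v))
     ++ opt (dropFirstC v) (λ v' → (1ℤ , u ++ d ∷ v'))
     ++ [ (+ 2 , u ++ c ∷ v) ]

-- ab-words (false = a, true = b) and the ab-index of the Boolean lattice

ABWord : Set
ABWord = List Bool

-- coefficient of the ab-word w in the ab-expansion of the cd-monomial v
-- (c = a + b, d = ab + ba)
expCoeff : CDMon → ABWord → ℤ
expCoeff [] [] = 1ℤ
expCoeff (c ∷ v) (x ∷ w) = expCoeff v w
expCoeff (d ∷ v) (x ∷ y ∷ w) = if x xor y then expCoeff v w else 0ℤ
expCoeff _ _ = 0ℤ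

positions : ℕ → ABWord → List ℕ
positions i [] = []
positions i (true ∷ w) = i ∷ positions (suc i) w
positions i (false ∷ w) = positions (suc i) w

-- number of chains ∅ ⊂ X₁ ⊂ … ⊂ X_k ⊂ [top] in the Boolean lattice with
-- |Xⱼ| = sⱼ, for s₁ < … < s_k: choose X_k ⊆ [top], then X_{k-1} ⊆ X_k, …
chains : ℕ → List ℕ → ℕ
chains top [] = 1
chains top (s ∷ []) = top C s
chains top (s ∷ t ∷ ss) = (t C s) Data.Nat.* chains top (t ∷ ss)

-- flag f-vector of B_{n+1} (rank n+1) at S ⊆ [n], S encoded by an ab-word of length n
flagF : ℕ → ABWord → ℕ
flagF n w = chains (suc n) (positions 1 w)

-- the subsets T ⊆ S together with the sign (-1)^{|S - T|}
subsetsSigned : ABWord → List (ABWord × ℤ)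
subsetsSigned [] = ([] , 1ℤ) ∷ []
subsetsSigned (false ∷ w) = map (λ { (t , s) → (false ∷ t , s) }) (subsetsSigned w)
subsetsSigned (true ∷ w) =
  map (λ { (t , s) → (true ∷ t , s) }) (subsetsSigned w)
  ++ map (λ { (t , s) → (false ∷ t , - s) }) (subsetsSigned w)

-- flag h-vector: h(S) = Σ_{T ⊆ S} (-1)^{|S-T|} f(T); this is the coefficient
-- of u_S in the ab-index Ψ(B_{n+1})
abIndexB : ℕ → ABWord → ℤ
abIndexB n w = sumℤ (map (λ { (t , s) → s * + flagF n t }) (subsetsSigned w))

-- ψ is the cd-index of the Boolean lattices: for every n, the cd-polynomial
-- Σ_{deg v = n} ψ(v) v expands to the ab-index of B_{n+1}.
-- (Hence ψ(v) = β(v), the coefficient of v in Ψ(B_{deg v + 1}).)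
IsCDIndexOfBoolean : (CDMon → ℤ) → Set
IsCDIndexOfBoolean ψ =
  (n : ℕ) (w : ABWord) → length w ≡ n →
  sumℤ (map (λ v → ψ v * expCoeff v w) (cdMons n)) ≡ abIndexB n w

βL : (CDMon → ℤ) → Lin → ℤ
βL β l = sumℤ (map (λ { (a , v) → a * β v }) l)

-- Expanded into ab-words, β is the alternating transform of the flag f-vector of
-- the Boolean lattice, f(S) = (n+1)! / Π gᵢ!, a multinomial coefficient in the
-- gaps gᵢ between consecutive elements of S ∪ {0, n+1}. This formula is invariant
-- under reversing S, and splitting S at one of its elements s factors it as
-- C(n+1, s) f(S ∩ [1, s)) f((S ∩ (s, n]) - s). The first fact gives β(v*) = β(v).
-- For the second, the ab-expansion turns · into the transpose of cutting an
-- ab-word at one letter, so that β(u · v) = C(deg u + deg v + 2, deg u + 1) β(u) β(v),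
-- which is symmetric in u and v and invariant under reversing either factor.

module Submission where

open import Defs
open import Data.Integer using (ℤ)
open import Data.Product using (_×_)
open import Relation.Binary.PropositionalEquality using (_≡_)

module Multinomial where

  open import Data.Bool using (true; false)
  open import Data.List using (_∷_; []; _++_; [_]; reverse; replicate; length)
  open import Data.List.Properties using (unfold-reverse; ++-assoc; ++-identityʳ; length-++; length-reverse)
  open import Data.Nat
  open import Data.Nat.Properties
  open import Data.Nat.Combinatorics using (_C_; nCk≡n!/k![n-k]!; k![n∸k]!∣n!)
  open import Data.Nat.DivMod using (_/_; m/n*n≡m)
  open import Data.Nat.Tactic.RingSolver using (solve-∀)
  open import Relation.Binary.PropositionalEquality hiding ([_])
  open ≡-Reasoning

  binomial-factorial : ∀ a b → ((a + b) C a) * (a ! * b !) ≡ (a + b) !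
  binomial-factorial a b = begin
    ((a + b) C a) * (a ! * b !)             ≡⟨ cong (λ m → ((a + b) C a) * (a ! * m !)) (m+n∸m≡n a b) ⟨
    ((a + b) C a) * (a ! * (a + b ∸ a) !)   ≡⟨ cong (_* (a ! * (a + b ∸ a) !)) (nCk≡n!/k![n-k]! a≤a+b) ⟩
    ((a + b) ! / (a ! * (a + b ∸ a) !)) * (a ! * (a + b ∸ a) !)  ≡⟨ m/n*n≡m (k![n∸k]!∣n! a≤a+b) ⟩
    (a + b) !                             ∎
    where
    a≤a+b = m≤m+n a b
    instance _ = a !* (a + b ∸ a) !≢0

  binomial-sym : ∀ a b → (a + b) C a ≡ (b + a) C b
  binomial-sym a b = *-cancelʳ-≡ _ _ (a ! * b !) {{a !* b !≢0}} (begin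
    ((a + b) C a) * (a ! * b !)  ≡⟨ binomial-factorial a b ⟩
    (a + b) !                    ≡⟨ cong _! (+-comm a b) ⟩
    (b + a) !                    ≡⟨ binomial-factorial b a ⟨
    ((b + a) C b) * (b ! * a !)  ≡⟨ cong (((b + a) C b) *_) (*-comm (b !) (a !)) ⟩
    ((b + a) C b) * (a ! * b !)  ∎)

  -- gapFactorials 0 w is the product of gᵢ ! over the gaps gᵢ between consecutive
  -- positions of b in w, with 0 and length w + 1 added as sentinels; the parameter
  -- k enlarges the first gap by k.
  gapFactorials : ℕ → ABWord → ℕ
  gapFactorials k []          = suc k !
  gapFactorials k (false ∷ w) = gapFactorials (suc k) w
  gapFactorials k (true ∷ w)  = suc k ! * gapFactorials 0 w

  gapFactorials≢0 : ∀ k w → NonZero (gapFactorials k w)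
  gapFactorials≢0 k []          = suc k !≢0
  gapFactorials≢0 k (false ∷ w) = gapFactorials≢0 (suc k) w
  gapFactorials≢0 k (true ∷ w)  = m*n≢0 (suc k !) (gapFactorials 0 w) {{suc k !≢0}} {{gapFactorials≢0 0 w}}

  -- j is the rank of the last chosen set and k the number of ranks skipped since.
  chains-multinomial : ∀ w j k {top} → j + suc k + length w ≡ top →
    chains top (j ∷ positions (j + suc k) w) * gapFactorials k w * j ! ≡ top !
  chains-multinomial [] j k refl rewrite +-identityʳ (j + suc k) = begin
    ((j + suc k) C j) * suc k ! * j !      ≡⟨ *-assoc ((j + suc k) C j) (suc k !) (j !) ⟩
    ((j + suc k) C j) * (suc k ! * j !)    ≡⟨ cong (((j + suc k) C j) *_) (*-comm (suc k !) (j !)) ⟩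
    ((j + suc k) C j) * (j ! * suc k !)    ≡⟨ binomial-factorial j (suc k) ⟩
    (j + suc k) !                          ∎
  chains-multinomial (false ∷ w) j k {top} e =
    subst (λ i → chains top (j ∷ positions i w) * gapFactorials (suc k) w * j ! ≡ top !)
          (+-suc j (suc k))
          (chains-multinomial w j (suc k) (trans (length-shift j (suc k) (length w)) e))
    where
    length-shift : ∀ a b l → a + suc b + l ≡ a + b + suc l
    length-shift = solve-∀
  chains-multinomial (true ∷ w) j k {top} e = begin
    (i C j) * X * (suc k ! * gapFactorials 0 w) * j !  ≡⟨ regroup (i C j) X (suc k !) (gapFactorials 0 w) (j !) ⟩
    X * gapFactorials 0 w * ((i C j) * (j ! * suc k !))  ≡⟨ cong (X * gapFactorials 0 w *_) (binomial-factorial j (suc k)) ⟩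
    X * gapFactorials 0 w * i !                         ≡⟨ subst (λ m → chains top (i ∷ positions m w) * gapFactorials 0 w * i ! ≡ top !)
                                                                 (+-comm i 1) (chains-multinomial w i 0 (trans (length-shift i (length w)) e)) ⟩
    top !                                               ∎
    where
    i = j + suc k
    X = chains top (i ∷ positions (suc i) w)
    regroup : ∀ a x f g h → a * x * (f * g) * h ≡ x * g * (a * (h * f))
    regroup = solve-∀
    length-shift : ∀ a l → a + 1 + l ≡ a + suc l
    length-shift = solve-∀

  flagF-multinomial : ∀ n t → length t ≡ n → flagF n t * gapFactorials 0 t ≡ suc n !
  flagF-multinomial n t e = begin
    chains (suc n) (positions 1 t) * gapFactorials 0 t          ≡⟨ cong (_* gapFactorials 0 t) (chains-0∷ (positions 1 t)) ⟨
    chains (suc n) (0 ∷ positions 1 t) * gapFactorials 0 t      ≡⟨ *-identityʳ _ ⟨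
    chains (suc n) (0 ∷ positions 1 t) * gapFactorials 0 t * 1  ≡⟨ chains-multinomial t 0 0 (cong suc e) ⟩
    suc n !                                                     ∎
    where
    chains-0∷ : ∀ xs → chains (suc n) (0 ∷ xs) ≡ chains (suc n) xs
    chains-0∷ []      = refl
    chains-0∷ (x ∷ _) = +-identityʳ _

  gapFactorials-++-true : ∀ k t t' → gapFactorials k (t ++ true ∷ t') ≡ gapFactorials k t * gapFactorials 0 t'
  gapFactorials-++-true k []          t' = refl
  gapFactorials-++-true k (false ∷ t) t' = gapFactorials-++-true (suc k) t t'
  gapFactorials-++-true k (true ∷ t)  t' =
    trans (cong (suc k ! *_) (gapFactorials-++-true 0 t t'))
          (sym (*-assoc (suc k !) (gapFactorials 0 t) (gapFactorials 0 t')))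

  gapFactorials-replicate : ∀ j k t → gapFactorials j (replicate k false ++ t) ≡ gapFactorials (j + k) t
  gapFactorials-replicate j zero    t = cong (λ m → gapFactorials m t) (sym (+-identityʳ j))
  gapFactorials-replicate j (suc k) t =
    trans (gapFactorials-replicate (suc j) k t) (cong (λ m → gapFactorials m t) (sym (+-suc j k)))

  gapFactorials-noB : ∀ k → gapFactorials 0 (replicate k false) ≡ suc k !
  gapFactorials-noB k = trans (cong (gapFactorials 0) (sym (++-identityʳ (replicate k false))))
                            (gapFactorials-replicate 0 k [])

  gapFactorials-reverse : ∀ t → gapFactorials 0 (reverse t) ≡ gapFactorials 0 t

  -- Reading t backwards, the k trailing letters a of the reversed prefix form the
  -- first gap of t.
  gapFactorials-reverse-++ : ∀ t k → gapFactorials 0 (reverse t ++ replicate k false) ≡ gapFactorials k t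
  gapFactorials-reverse-++ [] k = gapFactorials-noB k
  gapFactorials-reverse-++ (false ∷ t) k = begin
    gapFactorials 0 (reverse (false ∷ t) ++ replicate k false)       ≡⟨ cong (λ s → gapFactorials 0 (s ++ replicate k false)) (unfold-reverse false t) ⟩
    gapFactorials 0 ((reverse t ++ [ false ]) ++ replicate k false)  ≡⟨ cong (gapFactorials 0) (++-assoc (reverse t) [ false ] (replicate k false)) ⟩
    gapFactorials 0 (reverse t ++ replicate (suc k) false)           ≡⟨ gapFactorials-reverse-++ t (suc k) ⟩
    gapFactorials (suc k) t                                          ∎
  gapFactorials-reverse-++ (true ∷ t) k = begin
    gapFactorials 0 (reverse (true ∷ t) ++ replicate k false)       ≡⟨ cong (λ s → gapFactorials 0 (s ++ replicate k false)) (unfold-reverse true t) ⟩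
    gapFactorials 0 ((reverse t ++ [ true ]) ++ replicate k false)  ≡⟨ cong (gapFactorials 0) (++-assoc (reverse t) [ true ] (replicate k false)) ⟩
    gapFactorials 0 (reverse t ++ true ∷ replicate k false)         ≡⟨ gapFactorials-++-true 0 (reverse t) (replicate k false) ⟩
    gapFactorials 0 (reverse t) * gapFactorials 0 (replicate k false)  ≡⟨ cong₂ _*_ (gapFactorials-reverse t) (gapFactorials-noB k) ⟩
    gapFactorials 0 t * suc k !                                     ≡⟨ *-comm (gapFactorials 0 t) (suc k !) ⟩
    suc k ! * gapFactorials 0 t                                     ∎

  gapFactorials-reverse t = trans (cong (gapFactorials 0) (sym (++-identityʳ (reverse t))))
                                  (gapFactorials-reverse-++ t 0)

  flagF-reverse : ∀ n t → length t ≡ n → flagF n (reverse t) ≡ flagF n t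
  flagF-reverse n t e = *-cancelʳ-≡ _ _ (gapFactorials 0 t) {{gapFactorials≢0 0 t}} (begin
    flagF n (reverse t) * gapFactorials 0 t            ≡⟨ cong (flagF n (reverse t) *_) (gapFactorials-reverse t) ⟨
    flagF n (reverse t) * gapFactorials 0 (reverse t)  ≡⟨ flagF-multinomial n (reverse t) (trans (length-reverse t) e) ⟩
    suc n !                                            ≡⟨ flagF-multinomial n t e ⟨
    flagF n t * gapFactorials 0 t                      ∎)

  splitBinomial : ℕ → ℕ → ℕ
  splitBinomial p q = (suc p + suc q) C suc p

  splitBinomial-sym : ∀ p q → splitBinomial p q ≡ splitBinomial q p
  splitBinomial-sym p q = binomial-sym (suc p) (suc q)

  flagF-split : ∀ p q t t' → length t ≡ p → length t' ≡ q →
    flagF (p + suc q) (t ++ true ∷ t') ≡ splitBinomial p q * flagF p t * flagF q t'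
  flagF-split p q t t' e e' = *-cancelʳ-≡ _ _ (gapFactorials 0 t * gapFactorials 0 t')
      {{m*n≢0 _ _ {{gapFactorials≢0 0 t}} {{gapFactorials≢0 0 t'}}}} (begin
    flagF n (t ++ true ∷ t') * (g * g')
        ≡⟨ cong (flagF n (t ++ true ∷ t') *_) (gapFactorials-++-true 0 t t') ⟨
    flagF n (t ++ true ∷ t') * gapFactorials 0 (t ++ true ∷ t')
        ≡⟨ flagF-multinomial n (t ++ true ∷ t') (trans (length-++ t) (cong₂ _+_ e (cong suc e'))) ⟩
    (suc p + suc q) !
        ≡⟨ binomial-factorial (suc p) (suc q) ⟨
    splitBinomial p q * (suc p ! * suc q !)
        ≡⟨ cong (splitBinomial p q *_) (cong₂ _*_ (flagF-multinomial p t e) (flagF-multinomial q t' e')) ⟨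
    splitBinomial p q * ((flagF p t * g) * (flagF q t' * g'))
        ≡⟨ regroup (splitBinomial p q) (flagF p t) (flagF q t') g g' ⟩
    splitBinomial p q * flagF p t * flagF q t' * (g * g')  ∎)
    where
    n  = p + suc q
    g  = gapFactorials 0 t
    g' = gapFactorials 0 t'
    regroup : ∀ a x y u v → a * ((x * u) * (y * v)) ≡ a * x * y * (u * v)
    regroup = solve-∀

open Multinomial using (splitBinomial; splitBinomial-sym; flagF-reverse; flagF-split)

open import Data.Bool using (Bool; true; false; _xor_; if_then_else_)
open import Data.Bool.Properties using (xor-comm)
open import Data.Integer using (+_; -_; _+_; _-_; _*_; 0ℤ; 1ℤ)
open import Data.Integer.Properties using (+-identityˡ; +-identityʳ; +-assoc; *-identityˡ; *-identityʳ; *-zeroʳ; *-comm; *-assoc; neg-distrib-+; pos-*)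
open import Data.Integer.Tactic.RingSolver using (solve-∀)
open import Data.List using ([]; _∷_; _++_; _∷ʳ_; [_]; map; reverse; length; initLast; _∷ʳ′_)
open import Data.List.Properties using (unfold-reverse; reverse-++; reverse-involutive; length-++; length-reverse; map-∘; map-++)
open import Data.Nat using (suc)
import Data.Nat as ℕ
import Data.Nat.Properties as ℕₚ
open import Data.Product using (_,_; map₂)
open import Function using (_∘_)
open import Data.Empty using (⊥-elim)
open import Data.Maybe using (just; nothing)
import Data.Maybe as Maybe
open import Relation.Binary.PropositionalEquality hiding ([_])
open ≡-Reasoning

sumℤ-++ : ∀ xs ys → sumℤ (xs ++ ys) ≡ sumℤ xs + sumℤ ys
sumℤ-++ []       ys = sym (+-identityˡ (sumℤ ys))
sumℤ-++ (x ∷ xs) ys = trans (cong (_+_ x) (sumℤ-++ xs ys)) (sym (+-assoc x (sumℤ xs) (sumℤ ys)))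

sumℤ-map-++ : ∀ {A : Set} (f : A → ℤ) xs ys → sumℤ (map f (xs ++ ys)) ≡ sumℤ (map f xs) + sumℤ (map f ys)
sumℤ-map-++ f xs ys = trans (cong sumℤ (map-++ f xs ys)) (sumℤ-++ (map f xs) (map f ys))

-- Alternating subset sums

-- alternatingSum g w = Σ_{T ⊆ S} (-1)^{|S - T|} g T, where S is the set of
-- positions of b in w and T ⊆ S is encoded by an ab-word of the same length.
alternatingSum : (ABWord → ℤ) → ABWord → ℤ
alternatingSum g []          = g []
alternatingSum g (false ∷ w) = alternatingSum (g ∘ (false ∷_)) w
alternatingSum g (true ∷ w)  = alternatingSum (g ∘ (true ∷_)) w - alternatingSum (g ∘ (false ∷_)) w

alternatingSum-cong : ∀ w {g h : ABWord → ℤ} → (∀ t → length t ≡ length w → g t ≡ h t) →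
  alternatingSum g w ≡ alternatingSum h w
alternatingSum-cong []          g≗h = g≗h [] refl
alternatingSum-cong (false ∷ w) g≗h = alternatingSum-cong w (λ t e → g≗h (false ∷ t) (cong suc e))
alternatingSum-cong (true ∷ w)  g≗h = cong₂ _-_ (alternatingSum-cong w (λ t e → g≗h (true ∷ t) (cong suc e)))
                                                (alternatingSum-cong w (λ t e → g≗h (false ∷ t) (cong suc e)))

alternatingSum-neg : ∀ w (g : ABWord → ℤ) → alternatingSum (λ t → - g t) w ≡ - alternatingSum g w
alternatingSum-neg []          g = refl
alternatingSum-neg (false ∷ w) g = alternatingSum-neg w (g ∘ (false ∷_))
alternatingSum-neg (true ∷ w)  g = trans (cong₂ _-_ (alternatingSum-neg w (g ∘ (true ∷_))) (alternatingSum-neg w (g ∘ (false ∷_))))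
                                         (sym (neg-distrib-+ (alternatingSum (g ∘ (true ∷_)) w) (- alternatingSum (g ∘ (false ∷_)) w)))

alternatingSum-sub : ∀ w (g h : ABWord → ℤ) →
  alternatingSum (λ t → g t - h t) w ≡ alternatingSum g w - alternatingSum h w
alternatingSum-sub []          g h = refl
alternatingSum-sub (false ∷ w) g h = alternatingSum-sub w (g ∘ (false ∷_)) (h ∘ (false ∷_))
alternatingSum-sub (true ∷ w)  g h =
  trans (cong₂ _-_ (alternatingSum-sub w (g ∘ (true ∷_)) (h ∘ (true ∷_))) (alternatingSum-sub w (g ∘ (false ∷_)) (h ∘ (false ∷_))))
        ([a-b]-[c-d]≡[a-c]-[b-d] (alternatingSum (g ∘ (true ∷_)) w) (alternatingSum (h ∘ (true ∷_)) w)
                                 (alternatingSum (g ∘ (false ∷_)) w) (alternatingSum (h ∘ (false ∷_)) w))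
  where
  [a-b]-[c-d]≡[a-c]-[b-d] : ∀ a b c d → (a - b) - (c - d) ≡ (a - c) - (b - d)
  [a-b]-[c-d]≡[a-c]-[b-d] = solve-∀

alternatingSum-*ˡ : ∀ w k (g : ABWord → ℤ) → alternatingSum (λ t → k * g t) w ≡ k * alternatingSum g w
alternatingSum-*ˡ []          k g = refl
alternatingSum-*ˡ (false ∷ w) k g = alternatingSum-*ˡ w k (g ∘ (false ∷_))
alternatingSum-*ˡ (true ∷ w)  k g =
  trans (cong₂ _-_ (alternatingSum-*ˡ w k (g ∘ (true ∷_))) (alternatingSum-*ˡ w k (g ∘ (false ∷_))))
        (k*a-k*b≡k*[a-b] k _ _)
  where
  k*a-k*b≡k*[a-b] : ∀ k a b → k * a - k * b ≡ k * (a - b)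
  k*a-k*b≡k*[a-b] = solve-∀

alternatingSum-product : ∀ w w' (g h : ABWord → ℤ) →
  alternatingSum (λ t → alternatingSum (λ t' → g t * h t') w') w ≡ alternatingSum g w * alternatingSum h w'
alternatingSum-product w w' g h = begin
  alternatingSum (λ t → alternatingSum (λ t' → g t * h t') w') w  ≡⟨ alternatingSum-cong w (λ t _ → alternatingSum-*ˡ w' (g t) h) ⟩
  alternatingSum (λ t → g t * H) w                               ≡⟨ alternatingSum-cong w (λ t _ → *-comm (g t) H) ⟩
  alternatingSum (λ t → H * g t) w                               ≡⟨ alternatingSum-*ˡ w H g ⟩
  H * alternatingSum g w                                         ≡⟨ *-comm H _ ⟩
  alternatingSum g w * H                                         ∎
  where H = alternatingSum h w'

alternatingSum-++ : ∀ w w' (g : ABWord → ℤ) →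
  alternatingSum g (w ++ w') ≡ alternatingSum (λ t → alternatingSum (λ t' → g (t ++ t')) w') w
alternatingSum-++ []          w' g = refl
alternatingSum-++ (false ∷ w) w' g = alternatingSum-++ w w' (g ∘ (false ∷_))
alternatingSum-++ (true ∷ w)  w' g = cong₂ _-_ (alternatingSum-++ w w' (g ∘ (true ∷_))) (alternatingSum-++ w w' (g ∘ (false ∷_)))

alternatingSum-reverse : ∀ w (g : ABWord → ℤ) → alternatingSum g (reverse w) ≡ alternatingSum (g ∘ reverse) w
alternatingSum-reverse []          g = refl
alternatingSum-reverse (false ∷ w) g = begin
  alternatingSum g (reverse (false ∷ w))                    ≡⟨ cong (alternatingSum g) (unfold-reverse false w) ⟩
  alternatingSum g (reverse w ∷ʳ false)                     ≡⟨ alternatingSum-++ (reverse w) [ false ] g ⟩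
  alternatingSum (λ t → g (t ∷ʳ false)) (reverse w)         ≡⟨ alternatingSum-reverse w _ ⟩
  alternatingSum (λ t → g (reverse t ∷ʳ false)) w           ≡⟨ alternatingSum-cong w (λ t _ → cong g (unfold-reverse false t)) ⟨
  alternatingSum (g ∘ reverse) (false ∷ w)                  ∎
alternatingSum-reverse (true ∷ w) g = begin
  alternatingSum g (reverse (true ∷ w))                               ≡⟨ cong (alternatingSum g) (unfold-reverse true w) ⟩
  alternatingSum g (reverse w ∷ʳ true)                                ≡⟨ alternatingSum-++ (reverse w) [ true ] g ⟩
  alternatingSum (λ t → g (t ∷ʳ true) - g (t ∷ʳ false)) (reverse w)   ≡⟨ alternatingSum-reverse w _ ⟩
  alternatingSum (λ t → g (reverse t ∷ʳ true) - g (reverse t ∷ʳ false)) w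
      ≡⟨ alternatingSum-sub w _ _ ⟩
  alternatingSum (λ t → g (reverse t ∷ʳ true)) w - alternatingSum (λ t → g (reverse t ∷ʳ false)) w
      ≡⟨ cong₂ _-_ (alternatingSum-cong w (λ t _ → cong g (unfold-reverse true t)))
                   (alternatingSum-cong w (λ t _ → cong g (unfold-reverse false t))) ⟨
  alternatingSum (g ∘ reverse) (true ∷ w)                             ∎

-- Summing over the letter between w and w' cancels the signs at that position.
alternatingSum-split : ∀ w w' (g : ABWord → ℤ) →
  alternatingSum g (w ++ false ∷ w') + alternatingSum g (w ++ true ∷ w')
    ≡ alternatingSum (λ t → alternatingSum (λ t' → g (t ++ true ∷ t')) w') w
alternatingSum-split []          w' g = a+[b-a]≡b (alternatingSum (g ∘ (false ∷_)) w') (alternatingSum (g ∘ (true ∷_)) w')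
  where
  a+[b-a]≡b : ∀ a b → a + (b - a) ≡ b
  a+[b-a]≡b = solve-∀
alternatingSum-split (false ∷ w) w' g = alternatingSum-split w w' (g ∘ (false ∷_))
alternatingSum-split (true ∷ w)  w' g =
  trans ([a-b]+[c-d]≡[a+c]-[b+d] (σ (g ∘ (true ∷_)) (w ++ false ∷ w')) (σ (g ∘ (false ∷_)) (w ++ false ∷ w'))
                                 (σ (g ∘ (true ∷_)) (w ++ true ∷ w')) (σ (g ∘ (false ∷_)) (w ++ true ∷ w')))
        (cong₂ _-_ (alternatingSum-split w w' (g ∘ (true ∷_))) (alternatingSum-split w w' (g ∘ (false ∷_))))
  where
  σ = alternatingSum
  [a-b]+[c-d]≡[a+c]-[b+d] : ∀ a b c d → (a - b) + (c - d) ≡ (a + c) - (b + d)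
  [a-b]+[c-d]≡[a+c]-[b+d] = solve-∀

sumℤ-subsetsSigned : ∀ w (F : ABWord × ℤ → ℤ) (g : ABWord → ℤ) → (∀ t s → F (t , s) ≡ s * g t) →
  sumℤ (map F (subsetsSigned w)) ≡ alternatingSum g w
sumℤ-subsetsSigned [] F g F≗ = trans (cong (_+ 0ℤ) (F≗ [] 1ℤ)) (trans (+-identityʳ (1ℤ * g [])) (*-identityˡ (g [])))
sumℤ-subsetsSigned (false ∷ w) F g F≗ = begin
  sumℤ (map F (map (λ { (t , s) → false ∷ t , s }) (subsetsSigned w)))  ≡⟨ cong sumℤ (map-∘ (subsetsSigned w)) ⟨
  sumℤ (map (λ { (t , s) → F (false ∷ t , s) }) (subsetsSigned w))      ≡⟨ sumℤ-subsetsSigned w _ (g ∘ (false ∷_)) (λ t s → F≗ (false ∷ t) s) ⟩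
  alternatingSum (g ∘ (false ∷_)) w                                     ∎
sumℤ-subsetsSigned (true ∷ w) F g F≗ = begin
  sumℤ (map F (map (λ { (t , s) → true ∷ t , s }) ss ++ map (λ { (t , s) → false ∷ t , - s }) ss))
      ≡⟨ sumℤ-map-++ F (map (λ { (t , s) → true ∷ t , s }) ss) (map (λ { (t , s) → false ∷ t , - s }) ss) ⟩
  sumℤ (map F (map (λ { (t , s) → true ∷ t , s }) ss)) + sumℤ (map F (map (λ { (t , s) → false ∷ t , - s }) ss))
      ≡⟨ cong₂ _+_ (cong sumℤ (map-∘ ss)) (cong sumℤ (map-∘ ss)) ⟨
  sumℤ (map (λ { (t , s) → F (true ∷ t , s) }) ss) + sumℤ (map (λ { (t , s) → F (false ∷ t , - s) }) ss)
      ≡⟨ cong₂ _+_ (sumℤ-subsetsSigned w _ (g ∘ (true ∷_)) (λ t s → F≗ (true ∷ t) s))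
                   (sumℤ-subsetsSigned w _ (λ t → - g (false ∷ t)) (λ t s → trans (F≗ (false ∷ t) (- s)) (-s*x≡s*-x s (g (false ∷ t))))) ⟩
  alternatingSum (g ∘ (true ∷_)) w + alternatingSum (λ t → - g (false ∷ t)) w
      ≡⟨ cong (_+_ (alternatingSum (g ∘ (true ∷_)) w)) (alternatingSum-neg w (g ∘ (false ∷_))) ⟩
  alternatingSum g (true ∷ w) ∎
  where
  ss = subsetsSigned w
  -s*x≡s*-x : ∀ s x → - s * x ≡ s * - x
  -s*x≡s*-x = solve-∀

abIndexB≡alternatingSum : ∀ n w → abIndexB n w ≡ alternatingSum (λ t → + flagF n t) w
abIndexB≡alternatingSum n w = sumℤ-subsetsSigned w _ _ (λ t s → refl)

abIndexB-reverse : ∀ n w → length w ≡ n → abIndexB n (reverse w) ≡ abIndexB n w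
abIndexB-reverse n w e = begin
  abIndexB n (reverse w)                                ≡⟨ abIndexB≡alternatingSum n (reverse w) ⟩
  alternatingSum (λ t → + flagF n t) (reverse w)        ≡⟨ alternatingSum-reverse w _ ⟩
  alternatingSum (λ t → + flagF n (reverse t)) w        ≡⟨ alternatingSum-cong w (λ t e' → cong +_ (flagF-reverse n t (trans e' e))) ⟩
  alternatingSum (λ t → + flagF n t) w                  ≡⟨ abIndexB≡alternatingSum n w ⟨
  abIndexB n w                                          ∎

abIndexB-split : ∀ p q w w' → length w ≡ p → length w' ≡ q →
  abIndexB (p ℕ.+ suc q) (w ++ false ∷ w') + abIndexB (p ℕ.+ suc q) (w ++ true ∷ w')
    ≡ + splitBinomial p q * abIndexB p w * abIndexB q w'
abIndexB-split p q w w' e e' = begin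
  abIndexB n (w ++ false ∷ w') + abIndexB n (w ++ true ∷ w')
      ≡⟨ cong₂ _+_ (abIndexB≡alternatingSum n (w ++ false ∷ w')) (abIndexB≡alternatingSum n (w ++ true ∷ w')) ⟩
  alternatingSum f (w ++ false ∷ w') + alternatingSum f (w ++ true ∷ w')
      ≡⟨ alternatingSum-split w w' f ⟩
  alternatingSum (λ t → alternatingSum (λ t' → f (t ++ true ∷ t')) w') w
      ≡⟨ alternatingSum-cong w (λ t et → alternatingSum-cong w' (λ t' et' → split t t' (trans et e) (trans et' e'))) ⟩
  alternatingSum (λ t → alternatingSum (λ t' → (K * + flagF p t) * + flagF q t') w') w
      ≡⟨ alternatingSum-product w w' (λ t → K * + flagF p t) (λ t' → + flagF q t') ⟩
  alternatingSum (λ t → K * + flagF p t) w * alternatingSum (λ t' → + flagF q t') w'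
      ≡⟨ cong₂ _*_ (trans (alternatingSum-*ˡ w K _) (cong (K *_) (sym (abIndexB≡alternatingSum p w))))
                   (sym (abIndexB≡alternatingSum q w')) ⟩
  K * abIndexB p w * abIndexB q w'  ∎
  where
  n = p ℕ.+ suc q
  K = + splitBinomial p q
  f : ABWord → ℤ
  f t = + flagF n t
  split : ∀ t t' → length t ≡ p → length t' ≡ q → f (t ++ true ∷ t') ≡ (K * + flagF p t) * + flagF q t'
  split t t' et et' = begin
    + flagF n (t ++ true ∷ t')                              ≡⟨ cong +_ (flagF-split p q t t' et et') ⟩
    + (splitBinomial p q ℕ.* flagF p t ℕ.* flagF q t')      ≡⟨ pos-* (splitBinomial p q ℕ.* flagF p t) (flagF q t') ⟩
    + (splitBinomial p q ℕ.* flagF p t) * + flagF q t'      ≡⟨ cong (_* + flagF q t') (pos-* (splitBinomial p q) (flagF p t)) ⟩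
    (K * + flagF p t) * + flagF q t'                        ∎

-- The ab-expansion of cd-polynomials

⟦_⟧ : Bool → ℤ
⟦ true ⟧  = 1ℤ
⟦ false ⟧ = 0ℤ

-- abCoefficient γ w is the coefficient of the ab-word w in the ab-expansion of
-- the cd-polynomial Σ_v γ v · v: a leading c = a + b matches any letter, a
-- leading d = ab + ba matches two different letters.
abCoefficient : (CDMon → ℤ) → ABWord → ℤ
abCoefficient γ []          = γ []
abCoefficient γ (x ∷ [])    = γ [ c ]
abCoefficient γ (x ∷ y ∷ w) = abCoefficient (γ ∘ (c ∷_)) (y ∷ w) + ⟦ x xor y ⟧ * abCoefficient (γ ∘ (d ∷_)) w

abCoefficient-correct : ∀ (γ : CDMon → ℤ) w →
  sumℤ (map (λ v → γ v * expCoeff v w) (cdMons (length w))) ≡ abCoefficient γ w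
abCoefficient-correct γ []          = trans (+-identityʳ (γ [] * 1ℤ)) (*-identityʳ (γ []))
abCoefficient-correct γ (x ∷ [])    = trans (+-identityʳ (γ [ c ] * 1ℤ)) (*-identityʳ (γ [ c ]))
abCoefficient-correct γ (x ∷ y ∷ w) = begin
  sumℤ (map F (map (c ∷_) (cdMons (suc (length w))) ++ map (d ∷_) (cdMons (length w))))
      ≡⟨ sumℤ-map-++ F (map (c ∷_) (cdMons (suc (length w)))) (map (d ∷_) (cdMons (length w))) ⟩
  sumℤ (map F (map (c ∷_) (cdMons (suc (length w))))) + sumℤ (map F (map (d ∷_) (cdMons (length w))))
      ≡⟨ cong₂ _+_ (cong sumℤ (map-∘ (cdMons (suc (length w))))) (cong sumℤ (map-∘ (cdMons (length w)))) ⟨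
  sumℤ (map (λ v → γ (c ∷ v) * expCoeff v (y ∷ w)) (cdMons (suc (length w))))
    + sumℤ (map (λ v → γ (d ∷ v) * (if x xor y then expCoeff v w else 0ℤ)) (cdMons (length w)))
      ≡⟨ cong₂ _+_ (abCoefficient-correct (γ ∘ (c ∷_)) (y ∷ w)) (bracket (x xor y)) ⟩
  abCoefficient γ (x ∷ y ∷ w)  ∎
  where
  F : CDMon → ℤ
  F v = γ v * expCoeff v (x ∷ y ∷ w)
  sum0 : ∀ vs → sumℤ (map (λ v → γ (d ∷ v) * 0ℤ) vs) ≡ 0ℤ
  sum0 []       = refl
  sum0 (v ∷ vs) = cong₂ _+_ (*-zeroʳ (γ (d ∷ v))) (sum0 vs)
  bracket : ∀ b → sumℤ (map (λ v → γ (d ∷ v) * (if b then expCoeff v w else 0ℤ)) (cdMons (length w)))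
                    ≡ ⟦ b ⟧ * abCoefficient (γ ∘ (d ∷_)) w
  bracket true  = trans (abCoefficient-correct (γ ∘ (d ∷_)) w) (sym (*-identityˡ _))
  bracket false = sum0 (cdMons (length w))

abCoefficient-cong : ∀ w {γ γ' : CDMon → ℤ} → (∀ u → deg u ≡ length w → γ u ≡ γ' u) →
  abCoefficient γ w ≡ abCoefficient γ' w
abCoefficient-cong []          γ≗γ' = γ≗γ' [] refl
abCoefficient-cong (x ∷ [])    γ≗γ' = γ≗γ' [ c ] refl
abCoefficient-cong (x ∷ y ∷ w) γ≗γ' =
  cong₂ (λ A B → A + ⟦ x xor y ⟧ * B) (abCoefficient-cong (y ∷ w) (λ u e → γ≗γ' (c ∷ u) (cong suc e)))
                                      (abCoefficient-cong w (λ u e → γ≗γ' (d ∷ u) (cong (suc ∘ suc) e)))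

abCoefficient-cong′ : ∀ w {γ γ' : CDMon → ℤ} → (∀ u → γ u ≡ γ' u) → abCoefficient γ w ≡ abCoefficient γ' w
abCoefficient-cong′ w γ≗γ' = abCoefficient-cong w (λ u _ → γ≗γ' u)

abCoefficient-0 : ∀ w → abCoefficient (λ _ → 0ℤ) w ≡ 0ℤ
abCoefficient-0 []          = refl
abCoefficient-0 (x ∷ [])    = refl
abCoefficient-0 (x ∷ y ∷ w) =
  trans (cong₂ (λ A B → A + ⟦ x xor y ⟧ * B) (abCoefficient-0 (y ∷ w)) (abCoefficient-0 w))
        (trans (+-identityˡ (⟦ x xor y ⟧ * 0ℤ)) (*-zeroʳ ⟦ x xor y ⟧))

[a+a']+k*[b+b']≡[a+k*b]+[a'+k*b'] : ∀ a a' k b b' → (a + a') + k * (b + b') ≡ (a + k * b) + (a' + k * b')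
[a+a']+k*[b+b']≡[a+k*b]+[a'+k*b'] = solve-∀

abCoefficient-+ : ∀ w (γ γ' : CDMon → ℤ) →
  abCoefficient (λ u → γ u + γ' u) w ≡ abCoefficient γ w + abCoefficient γ' w
abCoefficient-+ []          γ γ' = refl
abCoefficient-+ (x ∷ [])    γ γ' = refl
abCoefficient-+ (x ∷ y ∷ w) γ γ' =
  trans (cong₂ (λ A B → A + ⟦ x xor y ⟧ * B) (abCoefficient-+ (y ∷ w) (γ ∘ (c ∷_)) (γ' ∘ (c ∷_)))
                                             (abCoefficient-+ w (γ ∘ (d ∷_)) (γ' ∘ (d ∷_))))
        ([a+a']+k*[b+b']≡[a+k*b]+[a'+k*b'] (abCoefficient (γ ∘ (c ∷_)) (y ∷ w)) (abCoefficient (γ' ∘ (c ∷_)) (y ∷ w))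
           ⟦ x xor y ⟧ (abCoefficient (γ ∘ (d ∷_)) w) (abCoefficient (γ' ∘ (d ∷_)) w))

abCoefficient-*ˡ : ∀ w k (γ : CDMon → ℤ) → abCoefficient (λ u → k * γ u) w ≡ k * abCoefficient γ w
abCoefficient-*ˡ []          k γ = refl
abCoefficient-*ˡ (x ∷ [])    k γ = refl
abCoefficient-*ˡ (x ∷ y ∷ w) k γ =
  trans (cong₂ (λ A B → A + ⟦ x xor y ⟧ * B) (abCoefficient-*ˡ (y ∷ w) k (γ ∘ (c ∷_))) (abCoefficient-*ˡ w k (γ ∘ (d ∷_))))
        (regroup k (abCoefficient (γ ∘ (c ∷_)) (y ∷ w)) ⟦ x xor y ⟧ (abCoefficient (γ ∘ (d ∷_)) w))
  where
  regroup : ∀ k a j b → k * a + j * (k * b) ≡ k * (a + j * b)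
  regroup = solve-∀

abCoefficient-product : ∀ w w' (γ γ' : CDMon → ℤ) →
  abCoefficient (λ u → abCoefficient (λ v → γ u * γ' v) w') w ≡ abCoefficient γ w * abCoefficient γ' w'
abCoefficient-product w w' γ γ' = begin
  abCoefficient (λ u → abCoefficient (λ v → γ u * γ' v) w') w  ≡⟨ abCoefficient-cong′ w (λ u → abCoefficient-*ˡ w' (γ u) γ') ⟩
  abCoefficient (λ u → γ u * G) w                             ≡⟨ abCoefficient-cong′ w (λ u → *-comm (γ u) G) ⟩
  abCoefficient (λ u → G * γ u) w                             ≡⟨ abCoefficient-*ˡ w G γ ⟩
  G * abCoefficient γ w                                       ≡⟨ *-comm G _ ⟩
  abCoefficient γ w * G                                       ∎
  where G = abCoefficient γ' w'

repeatHead : ABWord → ABWord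
repeatHead []      = [ false ]
repeatHead (y ∷ w) = y ∷ y ∷ w

abCoefficient-c∷ : ∀ (γ : CDMon → ℤ) w → abCoefficient (γ ∘ (c ∷_)) w ≡ abCoefficient γ (repeatHead w)
abCoefficient-c∷ γ []          = refl
abCoefficient-c∷ γ (false ∷ w) = sym (+-identityʳ _)
abCoefficient-c∷ γ (true ∷ w)  = sym (+-identityʳ _)

abCoefficient-d∷ : ∀ (γ : CDMon → ℤ) w →
  abCoefficient (γ ∘ (d ∷_)) w ≡ abCoefficient γ (true ∷ false ∷ w) - abCoefficient (γ ∘ (c ∷_)) (false ∷ w)
abCoefficient-d∷ γ w = b≡[a+1*b]-a (abCoefficient (γ ∘ (c ∷_)) (false ∷ w)) (abCoefficient (γ ∘ (d ∷_)) w)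
  where
  b≡[a+1*b]-a : ∀ a b → b ≡ (a + 1ℤ * b) - a
  b≡[a+1*b]-a = solve-∀

-- Repeating the first letter isolates the terms starting with c; then ba·w minus
-- aa·w isolates those starting with d.
abCoefficient-injective : ∀ {γ γ' : CDMon → ℤ} → (∀ w → abCoefficient γ w ≡ abCoefficient γ' w) → ∀ v → γ v ≡ γ' v
abCoefficient-injective         γ≈γ' []      = γ≈γ' []
abCoefficient-injective {γ} {γ'} γ≈γ' (c ∷ v) = abCoefficient-injective after-c v
  where
  after-c : ∀ w → abCoefficient (γ ∘ (c ∷_)) w ≡ abCoefficient (γ' ∘ (c ∷_)) w
  after-c w = trans (abCoefficient-c∷ γ w) (trans (γ≈γ' (repeatHead w)) (sym (abCoefficient-c∷ γ' w)))
abCoefficient-injective {γ} {γ'} γ≈γ' (d ∷ v) = abCoefficient-injective after-d v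
  where
  after-d : ∀ w → abCoefficient (γ ∘ (d ∷_)) w ≡ abCoefficient (γ' ∘ (d ∷_)) w
  after-d w = begin
    abCoefficient (γ ∘ (d ∷_)) w                                                     ≡⟨ abCoefficient-d∷ γ w ⟩
    abCoefficient γ (true ∷ false ∷ w) - abCoefficient (γ ∘ (c ∷_)) (false ∷ w)      ≡⟨ cong₂ _-_ (γ≈γ' (true ∷ false ∷ w))
                                                                                          (trans (abCoefficient-c∷ γ (false ∷ w)) (γ≈γ' (false ∷ false ∷ w))) ⟩
    abCoefficient γ' (true ∷ false ∷ w) - abCoefficient γ' (false ∷ false ∷ w)       ≡⟨ cong (_-_ (abCoefficient γ' (true ∷ false ∷ w))) (abCoefficient-c∷ γ' (false ∷ w)) ⟨
    abCoefficient γ' (true ∷ false ∷ w) - abCoefficient (γ' ∘ (c ∷_)) (false ∷ w)    ≡⟨ abCoefficient-d∷ γ' w ⟨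
    abCoefficient (γ' ∘ (d ∷_)) w                                                    ∎

abCoefficient-∷ʳ : ∀ (γ : CDMon → ℤ) w y x →
  abCoefficient γ (w ++ y ∷ x ∷ [])
    ≡ abCoefficient (λ u → γ (u ∷ʳ c)) (w ∷ʳ y) + ⟦ y xor x ⟧ * abCoefficient (λ u → γ (u ∷ʳ d)) w
abCoefficient-∷ʳ γ []           y x = refl
abCoefficient-∷ʳ γ (z ∷ [])     y x = regroup (γ (c ∷ c ∷ [ c ])) ⟦ y xor x ⟧ (γ (c ∷ [ d ])) ⟦ z xor y ⟧ (γ (d ∷ [ c ]))
  where
  regroup : ∀ a s b t e → (a + s * b) + t * e ≡ (a + t * e) + s * b
  regroup = solve-∀
abCoefficient-∷ʳ γ (z ∷ z' ∷ w) y x = begin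
  abCoefficient (γ ∘ (c ∷_)) (z' ∷ w ++ y ∷ x ∷ []) + t * abCoefficient (γ ∘ (d ∷_)) (w ++ y ∷ x ∷ [])
      ≡⟨ cong₂ (λ P Q → P + t * Q) (abCoefficient-∷ʳ (γ ∘ (c ∷_)) (z' ∷ w) y x) (abCoefficient-∷ʳ (γ ∘ (d ∷_)) w y x) ⟩
  (A + s * B) + t * (C + s * E)  ≡⟨ regroup A s B t C E ⟩
  (A + t * C) + s * (B + t * E)  ∎
  where
  s = ⟦ y xor x ⟧
  t = ⟦ z xor z' ⟧
  A = abCoefficient (λ u → γ (c ∷ u ∷ʳ c)) (z' ∷ w ∷ʳ y)
  B = abCoefficient (λ u → γ (c ∷ u ∷ʳ d)) (z' ∷ w)
  C = abCoefficient (λ u → γ (d ∷ u ∷ʳ c)) (w ∷ʳ y)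
  E = abCoefficient (λ u → γ (d ∷ u ∷ʳ d)) w
  regroup : ∀ a s b t e f → (a + s * b) + t * (e + s * f) ≡ (a + t * e) + s * (b + t * f)
  regroup = solve-∀

abCoefficient-reverse : ∀ (γ : CDMon → ℤ) w → abCoefficient (γ ∘ reverse) w ≡ abCoefficient γ (reverse w)
abCoefficient-reverse γ []          = refl
abCoefficient-reverse γ (x ∷ [])    = refl
abCoefficient-reverse γ (x ∷ y ∷ w) = begin
  abCoefficient (γ ∘ reverse ∘ (c ∷_)) (y ∷ w) + ⟦ x xor y ⟧ * abCoefficient (γ ∘ reverse ∘ (d ∷_)) w
      ≡⟨ cong₂ (λ P Q → P + ⟦ x xor y ⟧ * Q) (abCoefficient-cong′ (y ∷ w) (λ u → cong γ (unfold-reverse c u)))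
                                             (abCoefficient-cong′ w (λ u → cong γ (unfold-reverse d u))) ⟩
  abCoefficient (γc ∘ reverse) (y ∷ w) + ⟦ x xor y ⟧ * abCoefficient (γd ∘ reverse) w
      ≡⟨ cong₂ (λ P Q → P + ⟦ x xor y ⟧ * Q) (abCoefficient-reverse γc (y ∷ w)) (abCoefficient-reverse γd w) ⟩
  abCoefficient γc (reverse (y ∷ w)) + ⟦ x xor y ⟧ * abCoefficient γd (reverse w)
      ≡⟨ cong₂ (λ P b → abCoefficient γc P + ⟦ b ⟧ * abCoefficient γd (reverse w)) (unfold-reverse y w) (xor-comm x y) ⟩
  abCoefficient γc (reverse w ∷ʳ y) + ⟦ y xor x ⟧ * abCoefficient γd (reverse w)
      ≡⟨ abCoefficient-∷ʳ γ (reverse w) y x ⟨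
  abCoefficient γ (reverse w ++ y ∷ x ∷ [])
      ≡⟨ cong (abCoefficient γ) (reverse-++ (x ∷ [ y ]) w) ⟨
  abCoefficient γ (reverse (x ∷ y ∷ w))  ∎
  where
  γc γd : CDMon → ℤ
  γc u = γ (u ∷ʳ c)
  γd u = γ (u ∷ʳ d)

-- The product ·

deg-++ : ∀ u v → deg (u ++ v) ≡ deg u ℕ.+ deg v
deg-++ []      v = refl
deg-++ (c ∷ u) v = cong suc (deg-++ u v)
deg-++ (d ∷ u) v = cong (suc ∘ suc) (deg-++ u v)

deg-reverse : ∀ v → deg (reverse v) ≡ deg v
deg-reverse []      = refl
deg-reverse (x ∷ v) = begin
  deg (reverse (x ∷ v))          ≡⟨ cong deg (unfold-reverse x v) ⟩
  deg (reverse v ∷ʳ x)           ≡⟨ deg-++ (reverse v) [ x ] ⟩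
  deg (reverse v) ℕ.+ deg [ x ]  ≡⟨ cong (ℕ._+ deg [ x ]) (deg-reverse v) ⟩
  deg v ℕ.+ deg [ x ]            ≡⟨ ℕₚ.+-comm (deg v) (deg [ x ]) ⟩
  deg [ x ] ℕ.+ deg v            ≡⟨ deg-++ [ x ] v ⟨
  deg (x ∷ v)                    ∎

dropLastC-∷ʳc : ∀ s → dropLastC (s ∷ʳ c) ≡ just s
dropLastC-∷ʳc s rewrite reverse-++ s [ c ] | reverse-involutive s = refl

dropLastC-∷ʳd : ∀ s → dropLastC (s ∷ʳ d) ≡ nothing
dropLastC-∷ʳd s rewrite reverse-++ s [ d ] = refl

dropLastC-∷ : ∀ x u → u ≢ [] → dropLastC (x ∷ u) ≡ Maybe.map (x ∷_) (dropLastC u)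
dropLastC-∷ x u u≢[] with initLast u
... | []      = ⊥-elim (u≢[] refl)
... | s ∷ʳ′ c = trans (dropLastC-∷ʳc (x ∷ s)) (cong (Maybe.map (x ∷_)) (sym (dropLastC-∷ʳc s)))
... | s ∷ʳ′ d = trans (dropLastC-∷ʳd (x ∷ s)) (cong (Maybe.map (x ∷_)) (sym (dropLastC-∷ʳd s)))

dropLastC-d∷ : ∀ u → dropLastC (d ∷ u) ≡ Maybe.map (d ∷_) (dropLastC u)
dropLastC-d∷ []      = refl
dropLastC-d∷ (y ∷ u) = dropLastC-∷ d (y ∷ u) (λ ())

-- The hypothesis fails only for x = c and u = [], see [c]·.
·-prefix : ∀ x u v → dropLastC (x ∷ u) ≡ Maybe.map (x ∷_) (dropLastC u) →
  (x ∷ u) · v ≡ map (map₂ (x ∷_)) (u · v)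
·-prefix x u v eq rewrite eq with dropLastC u | dropFirstC v
... | just _  | just _  = refl
... | just _  | nothing = refl
... | nothing | just _  = refl
... | nothing | nothing = refl

[c]· : ∀ v → (c ∷ []) · v ≡ (1ℤ , d ∷ v) ∷ map (map₂ (c ∷_)) ([] · v)
[c]· v with dropFirstC v
... | just _  = refl
... | nothing = refl

βL-map₂ : ∀ (β : CDMon → ℤ) x l → βL β (map (map₂ (x ∷_)) l) ≡ βL (β ∘ (x ∷_)) l
βL-map₂ β x []            = refl
βL-map₂ β x ((a , v) ∷ l) = cong (_+_ (a * β (x ∷ v))) (βL-map₂ β x l)

βL-prefix : ∀ (β : CDMon → ℤ) x u v → dropLastC (x ∷ u) ≡ Maybe.map (x ∷_) (dropLastC u) →
  βL β ((x ∷ u) · v) ≡ βL (β ∘ (x ∷_)) (u · v)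
βL-prefix β x u v eq = trans (cong (βL β) (·-prefix x u v eq)) (βL-map₂ β x (u · v))

βL-[c]· : ∀ (β : CDMon → ℤ) v → βL β ((c ∷ []) · v) ≡ β (d ∷ v) + βL (β ∘ (c ∷_)) ([] · v)
βL-[c]· β v = begin
  βL β ((c ∷ []) · v)                                  ≡⟨ cong (βL β) ([c]· v) ⟩
  1ℤ * β (d ∷ v) + βL β (map (map₂ (c ∷_)) ([] · v))   ≡⟨ cong₂ _+_ (*-identityˡ (β (d ∷ v))) (βL-map₂ β c ([] · v)) ⟩
  β (d ∷ v) + βL (β ∘ (c ∷_)) ([] · v)                 ∎

withLeadingD : (CDMon → ℤ) → CDMon → ℤ
withLeadingD γ (c ∷ v) = γ (d ∷ v)
withLeadingD γ _       = 0ℤ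

βL-[]· : ∀ (β : CDMon → ℤ) v → βL β ([] · v) ≡ withLeadingD β v + + 2 * β (c ∷ v)
βL-[]· β []      = trans (+-identityʳ (+ 2 * β [ c ])) (sym (+-identityˡ (+ 2 * β [ c ])))
βL-[]· β (c ∷ v) = cong₂ _+_ (*-identityˡ (β (d ∷ v))) (+-identityʳ (+ 2 * β (c ∷ c ∷ v)))
βL-[]· β (d ∷ v) = trans (+-identityʳ (+ 2 * β (c ∷ d ∷ v))) (sym (+-identityˡ (+ 2 * β (c ∷ d ∷ v))))

xor-false+xor-true : ∀ x → ⟦ x xor false ⟧ + ⟦ x xor true ⟧ ≡ 1ℤ
xor-false+xor-true false = refl
xor-false+xor-true true  = refl

false-xor+true-xor : ∀ y → ⟦ false xor y ⟧ + ⟦ true xor y ⟧ ≡ 1ℤ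
false-xor+true-xor y = trans (cong₂ (λ a b → ⟦ a ⟧ + ⟦ b ⟧) (xor-comm false y) (xor-comm true y)) (xor-false+xor-true y)

abCoefficient-withLeadingD : ∀ (γ : CDMon → ℤ) y w → abCoefficient (withLeadingD γ) (y ∷ w) ≡ abCoefficient (γ ∘ (d ∷_)) w
abCoefficient-withLeadingD γ y []      = refl
abCoefficient-withLeadingD γ y (z ∷ w) = begin
  A + ⟦ y xor z ⟧ * abCoefficient (λ _ → 0ℤ) w  ≡⟨ cong (λ t → A + ⟦ y xor z ⟧ * t) (abCoefficient-0 w) ⟩
  A + ⟦ y xor z ⟧ * 0ℤ                          ≡⟨ cong (_+_ A) (*-zeroʳ ⟦ y xor z ⟧) ⟩
  A + 0ℤ                                        ≡⟨ +-identityʳ A ⟩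
  A                                             ∎
  where A = abCoefficient (γ ∘ (d ∷_)) (z ∷ w)

abCoefficient-false+true : ∀ (γ : CDMon → ℤ) w →
  abCoefficient γ (false ∷ w) + abCoefficient γ (true ∷ w)
    ≡ abCoefficient (withLeadingD γ) w + + 2 * abCoefficient (γ ∘ (c ∷_)) w
abCoefficient-false+true γ []      = a+a≡0+2*a (γ [ c ])
  where
  a+a≡0+2*a : ∀ a → a + a ≡ 0ℤ + + 2 * a
  a+a≡0+2*a = solve-∀
abCoefficient-false+true γ (y ∷ w) = begin
  (A + ⟦ false xor y ⟧ * B) + (A + ⟦ true xor y ⟧ * B)  ≡⟨ regroup A ⟦ false xor y ⟧ B ⟦ true xor y ⟧ ⟩
  (⟦ false xor y ⟧ + ⟦ true xor y ⟧) * B + + 2 * A      ≡⟨ cong (λ i → i * B + + 2 * A) (false-xor+true-xor y) ⟩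
  1ℤ * B + + 2 * A                                      ≡⟨ cong (_+ + 2 * A) (*-identityˡ B) ⟩
  B + + 2 * A                                           ≡⟨ cong (_+ + 2 * A) (abCoefficient-withLeadingD γ y w) ⟨
  abCoefficient (withLeadingD γ) (y ∷ w) + + 2 * A      ∎
  where
  A = abCoefficient (γ ∘ (c ∷_)) (y ∷ w)
  B = abCoefficient (γ ∘ (d ∷_)) w
  regroup : ∀ a i b j → (a + i * b) + (a + j * b) ≡ (i + j) * b + + 2 * a
  regroup = solve-∀

abCoefficient-· : ∀ (β : CDMon → ℤ) w w' →
  abCoefficient (λ u → abCoefficient (λ v → βL β (u · v)) w') w
    ≡ abCoefficient β (w ++ false ∷ w') + abCoefficient β (w ++ true ∷ w')
abCoefficient-· β [] w' = begin
  abCoefficient (λ v → βL β ([] · v)) w'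
      ≡⟨ abCoefficient-cong′ w' (βL-[]· β) ⟩
  abCoefficient (λ v → withLeadingD β v + + 2 * β (c ∷ v)) w'
      ≡⟨ abCoefficient-+ w' (withLeadingD β) (λ v → + 2 * β (c ∷ v)) ⟩
  abCoefficient (withLeadingD β) w' + abCoefficient (λ v → + 2 * β (c ∷ v)) w'
      ≡⟨ cong (_+_ (abCoefficient (withLeadingD β) w')) (abCoefficient-*ˡ w' (+ 2) (β ∘ (c ∷_))) ⟩
  abCoefficient (withLeadingD β) w' + + 2 * abCoefficient (β ∘ (c ∷_)) w'
      ≡⟨ abCoefficient-false+true β w' ⟨
  abCoefficient β (false ∷ w') + abCoefficient β (true ∷ w')  ∎
abCoefficient-· β (x ∷ []) w' = begin
  abCoefficient (λ v → βL β ((c ∷ []) · v)) w'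
      ≡⟨ abCoefficient-cong′ w' (βL-[c]· β) ⟩
  abCoefficient (λ v → β (d ∷ v) + βL (β ∘ (c ∷_)) ([] · v)) w'
      ≡⟨ abCoefficient-+ w' (β ∘ (d ∷_)) (λ v → βL (β ∘ (c ∷_)) ([] · v)) ⟩
  Q + abCoefficient (λ v → βL (β ∘ (c ∷_)) ([] · v)) w'
      ≡⟨ cong (_+_ Q) (abCoefficient-· (β ∘ (c ∷_)) [] w') ⟩
  Q + (P + R)
      ≡⟨ cong (λ t → t + (P + R)) (*-identityˡ Q) ⟨
  1ℤ * Q + (P + R)
      ≡⟨ cong (λ t → t * Q + (P + R)) (xor-false+xor-true x) ⟨
  (⟦ x xor false ⟧ + ⟦ x xor true ⟧) * Q + (P + R)
      ≡⟨ regroup P R Q ⟦ x xor false ⟧ ⟦ x xor true ⟧ ⟩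
  (P + ⟦ x xor false ⟧ * Q) + (R + ⟦ x xor true ⟧ * Q)  ∎
  where
  P = abCoefficient (β ∘ (c ∷_)) (false ∷ w')
  R = abCoefficient (β ∘ (c ∷_)) (true ∷ w')
  Q = abCoefficient (β ∘ (d ∷_)) w'
  regroup : ∀ p r q i j → (i + j) * q + (p + r) ≡ (p + i * q) + (r + j * q)
  regroup = solve-∀
abCoefficient-· β (x ∷ y ∷ w) w' = begin
  abCoefficient (λ u → abCoefficient (λ v → βL β ((c ∷ u) · v)) w') (y ∷ w)
    + ⟦ x xor y ⟧ * abCoefficient (λ u → abCoefficient (λ v → βL β ((d ∷ u) · v)) w') w
      ≡⟨ cong₂ (λ P Q → P + ⟦ x xor y ⟧ * Q) (abCoefficient-cong (y ∷ w) after-c) (abCoefficient-cong′ w after-d) ⟩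
  abCoefficient (λ u → abCoefficient (λ v → βL (β ∘ (c ∷_)) (u · v)) w') (y ∷ w)
    + ⟦ x xor y ⟧ * abCoefficient (λ u → abCoefficient (λ v → βL (β ∘ (d ∷_)) (u · v)) w') w
      ≡⟨ cong₂ (λ P Q → P + ⟦ x xor y ⟧ * Q) (abCoefficient-· (β ∘ (c ∷_)) (y ∷ w) w') (abCoefficient-· (β ∘ (d ∷_)) w w') ⟩
  (A false + A true) + ⟦ x xor y ⟧ * (B false + B true)
      ≡⟨ [a+a']+k*[b+b']≡[a+k*b]+[a'+k*b'] (A false) (A true) ⟦ x xor y ⟧ (B false) (B true) ⟩
  (A false + ⟦ x xor y ⟧ * B false) + (A true + ⟦ x xor y ⟧ * B true)  ∎
  where
  A B : Bool → ℤ
  A b = abCoefficient (β ∘ (c ∷_)) (y ∷ w ++ b ∷ w')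
  B b = abCoefficient (β ∘ (d ∷_)) (w ++ b ∷ w')
  after-c : ∀ u → deg u ≡ length (y ∷ w) →
    abCoefficient (λ v → βL β ((c ∷ u) · v)) w' ≡ abCoefficient (λ v → βL (β ∘ (c ∷_)) (u · v)) w'
  after-c (z ∷ u) _ = abCoefficient-cong′ w' (λ v → βL-prefix β c (z ∷ u) v (dropLastC-∷ c (z ∷ u) (λ ())))
  after-d : ∀ u → abCoefficient (λ v → βL β ((d ∷ u) · v)) w' ≡ abCoefficient (λ v → βL (β ∘ (d ∷_)) (u · v)) w'
  after-d u = abCoefficient-cong′ w' (λ v → βL-prefix β d u v (dropLastC-d∷ u))

abCoefficient₂-injective : ∀ {Φ Ψ : CDMon → CDMon → ℤ} →
  (∀ w w' → abCoefficient (λ u → abCoefficient (Φ u) w') w ≡ abCoefficient (λ u → abCoefficient (Ψ u) w') w) →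
  ∀ u v → Φ u v ≡ Ψ u v
abCoefficient₂-injective Φ≈Ψ u = abCoefficient-injective (λ w' → abCoefficient-injective (λ w → Φ≈Ψ w w') u)

-- The cd-index of the Boolean lattices

module _ (β : CDMon → ℤ) (isIndex : IsCDIndexOfBoolean β) where

  abCoefficient-β : ∀ w → abCoefficient β w ≡ abIndexB (length w) w
  abCoefficient-β w = trans (sym (abCoefficient-correct β w)) (isIndex (length w) w refl)

  β-reverse : ∀ v → β (reverse v) ≡ β v
  β-reverse = abCoefficient-injective λ w → begin
    abCoefficient (β ∘ reverse) w              ≡⟨ abCoefficient-reverse β w ⟩
    abCoefficient β (reverse w)                ≡⟨ abCoefficient-β (reverse w) ⟩
    abIndexB (length (reverse w)) (reverse w)  ≡⟨ cong (λ n → abIndexB n (reverse w)) (length-reverse w) ⟩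
    abIndexB (length w) (reverse w)            ≡⟨ abIndexB-reverse (length w) w refl ⟩
    abIndexB (length w) w                      ≡⟨ abCoefficient-β w ⟨
    abCoefficient β w                          ∎

  β-product : ∀ u v → βL β (u · v) ≡ + splitBinomial (deg u) (deg v) * β u * β v
  β-product = abCoefficient₂-injective λ w w' →
    let p = length w; q = length w'; K = + splitBinomial p q in begin
    abCoefficient (λ u → abCoefficient (λ v → βL β (u · v)) w') w
        ≡⟨ abCoefficient-· β w w' ⟩
    abCoefficient β (w ++ false ∷ w') + abCoefficient β (w ++ true ∷ w')
        ≡⟨ cong₂ _+_ (abCoefficient-β-++ w w' false) (abCoefficient-β-++ w w' true) ⟩
    abIndexB (p ℕ.+ suc q) (w ++ false ∷ w') + abIndexB (p ℕ.+ suc q) (w ++ true ∷ w')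
        ≡⟨ abIndexB-split p q w w' refl refl ⟩
    K * abIndexB p w * abIndexB q w'
        ≡⟨ cong₂ (λ a b → K * a * b) (abCoefficient-β w) (abCoefficient-β w') ⟨
    K * abCoefficient β w * abCoefficient β w'
        ≡⟨ cong (_* abCoefficient β w') (abCoefficient-*ˡ w K β) ⟨
    abCoefficient (λ u → K * β u) w * abCoefficient β w'
        ≡⟨ abCoefficient-product w w' (λ u → K * β u) β ⟨
    abCoefficient (λ u → abCoefficient (λ v → K * β u * β v) w') w
        ≡⟨ abCoefficient-cong w (λ u du → abCoefficient-cong w' (λ v dv →
             cong₂ (λ m n → + splitBinomial m n * β u * β v) (sym du) (sym dv))) ⟩
    abCoefficient (λ u → abCoefficient (λ v → + splitBinomial (deg u) (deg v) * β u * β v) w') w  ∎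
    where
    abCoefficient-β-++ : ∀ w w' b → abCoefficient β (w ++ b ∷ w') ≡ abIndexB (length w ℕ.+ suc (length w')) (w ++ b ∷ w')
    abCoefficient-β-++ w w' b = trans (abCoefficient-β (w ++ b ∷ w')) (cong (λ n → abIndexB n (w ++ b ∷ w')) (length-++ w))

  βL-·-determined : ∀ u u' v v' → deg u ≡ deg u' → β u ≡ β u' → deg v ≡ deg v' → β v ≡ β v' →
    βL β (u · v) ≡ βL β (u' · v')
  βL-·-determined u u' v v' du βu dv βv = begin
    βL β (u · v)                                     ≡⟨ β-product u v ⟩
    + splitBinomial (deg u) (deg v) * β u * β v      ≡⟨ cong₂ (λ m n → + splitBinomial m n * β u * β v) du dv ⟩
    + splitBinomial (deg u') (deg v') * β u * β v    ≡⟨ cong₂ (λ a b → + splitBinomial (deg u') (deg v') * a * b) βu βv ⟩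
    + splitBinomial (deg u') (deg v') * β u' * β v'  ≡⟨ β-product u' v' ⟨
    βL β (u' · v')                                   ∎

  βL-·-comm : ∀ u v → βL β (u · v) ≡ βL β (v · u)
  βL-·-comm u v = begin
    βL β (u · v)                        ≡⟨ β-product u v ⟩
    + K (deg u) (deg v) * β u * β v     ≡⟨ cong (λ k → + k * β u * β v) (splitBinomial-sym (deg u) (deg v)) ⟩
    + K (deg v) (deg u) * β u * β v     ≡⟨ *-assoc (+ K (deg v) (deg u)) (β u) (β v) ⟩
    + K (deg v) (deg u) * (β u * β v)   ≡⟨ cong (+ K (deg v) (deg u) *_) (*-comm (β u) (β v)) ⟩
    + K (deg v) (deg u) * (β v * β u)   ≡⟨ *-assoc (+ K (deg v) (deg u)) (β v) (β u) ⟨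
    + K (deg v) (deg u) * β v * β u     ≡⟨ β-product v u ⟨
    βL β (v · u)                        ∎
    where K = splitBinomial

lemma3p7 : (β : CDMon → ℤ) → IsCDIndexOfBoolean β → (u v : CDMon) →
    (βL β (u · v) ≡ βL β (u · (v ⋆)) × βL β (u · v) ≡ βL β ((u ⋆) · v))
    × βL β (u · v) ≡ βL β (v · u)
lemma3p7 β isIndex u v =
  ( ( βL-·-determined β isIndex u u v (v ⋆) refl refl (sym (deg-reverse v)) (sym (β-reverse β isIndex v))
    , βL-·-determined β isIndex u (u ⋆) v v (sym (deg-reverse u)) (sym (β-reverse β isIndex u)) refl refl )
  , βL-·-comm β isIndex u v )
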